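{- If a finite simple undirected graph $G$ has an involutive automorphism with no fixed edges, then $G$ is P2-win.
   Context: Trail Trap on a finite simple undirected graph $G$: Player 1 (P1) chooses a vertex, places a token on it and moves it along an incident edge $e$ to the other endpoint. Player 2 (P2) then places their own token on any vertex and moves it along an incident edge $f \neq e$. Thereafter the players alternate, starting with P1, each moving their own token from its current vertex along an unused edge (an edge not previously traversed, in either direction, by either player) to the adjacent vertex; vertices may be revisited and the two tokens may share a vertex. The first player unable to move loses. $G$ is P1-win if P1 has a winning strategy, and P2-win otherwise. An automorphism $\phi$ of $G$ is involutive if $\phi(\phi(v)) = v$ for all $v$. An edge $v_iv_j$ is a fixed edge of $\phi$ if either $\phi(v_i)=v_j$ and $\phi(v_j)=v_i$, or $\phi(v_i)=v_i$ and $\phi(v_j)=v_j$. -}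

module Defs where

open import Data.Nat using (ℕ)
open import Data.Fin using (Fin)
open import Data.Bool using (Bool; true; false)
open import Data.Product using (Σ; ∃; ∃-syntax; _×_; _,_)
open import Data.Sum using (_⊎_)
open import Data.List using (List; []; _∷_)
open import Data.List.Membership.Propositional using (_∈_)
open import Relation.Nullary using (¬_)
open import Relation.Binary.PropositionalEquality using (_≡_)

record Graph (n : ℕ) : Set where
  field
    E      : Fin n → Fin n → Bool
    sym    : ∀ x y → E x y ≡ E y x
    irrefl : ∀ x → E x x ≡ false

module _ {n : ℕ} (G : Graph n) where
  open Graph G

  Adj : Fin n → Fin n → Set
  Adj x y = E x y ≡ true

  Used : List (Fin n × Fin n) → Fin n → Fin n → Set
  Used L x y = ((x , y) ∈ L) ⊎ ((y , x) ∈ L)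

  -- Game positions after the opening: the player to move has token at 'me',
  -- the opponent has token at 'opp', and 'L' records traversed edges.
  -- Loses me opp L : every legal move of the player to move leads to a
  --                  position from which the opponent (then to move) wins.
  -- (A player with no legal move loses.)
  data Wins  : Fin n → Fin n → List (Fin n × Fin n) → Set
  data Loses : Fin n → Fin n → List (Fin n × Fin n) → Set

  data Wins where
    win : ∀ {me opp L} (y : Fin n) → Adj me y → ¬ Used L me y →
          Loses opp y ((me , y) ∷ L) → Wins me opp L

  data Loses where
    lose : ∀ {me opp L} →
           (∀ y → Adj me y → ¬ Used L me y → Wins opp y ((me , y) ∷ L)) →
           Loses me opp L

  -- P1 has a winning strategy: P1 picks a vertex v and moves along edge vw;
  -- for every opening of P2 (any vertex u, moving along an edge ut ≠ vw),
  -- P1, now to move at w with P2's token at t, wins.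
  P1-win : Set
  P1-win = ∃[ v ] ∃[ w ] (Adj v w ×
             (∀ u t → Adj u t → ¬ Used ((v , w) ∷ []) u t →
                Wins w t ((u , t) ∷ (v , w) ∷ [])))

  P2-win : Set
  P2-win = ¬ P1-win

  -- Automorphism of G (a map preserving adjacency and non-adjacency);
  -- involutive maps are automatically bijective.
  IsAutomorphism : (Fin n → Fin n) → Set
  IsAutomorphism φ = ∀ x y → E (φ x) (φ y) ≡ E x y

  Involutive : (Fin n → Fin n) → Set
  Involutive φ = ∀ v → φ (φ v) ≡ v

  FixedEdge : (Fin n → Fin n) → Fin n → Fin n → Set
  FixedEdge φ x y = ((φ x ≡ y) × (φ y ≡ x)) ⊎ ((φ x ≡ x) × (φ y ≡ y))

  NoFixedEdges : (Fin n → Fin n) → Set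
  NoFixedEdges φ = ∀ x y → Adj x y → ¬ FixedEdge φ x y

-- P2 mirrors: after P1 traverses xy, P2 traverses φx φy. Inductively P2's token
-- sits at the image of P1's and the set of used edges is closed under φ, so the
-- mirror of a legal P1 move was unused before it; it is not the edge P1 just
-- took either, since that edge would then be fixed by φ. Hence P2 can always
-- answer, and as the game is finite P1 eventually cannot move.
module Submission where

open import Defs
open import Data.Nat using (ℕ)
open import Data.Fin using (Fin)
open import Data.Product using (∃-syntax; _×_; _,_; swap)
open import Data.Product.Properties using (,-injective)
open import Data.Sum using (_⊎_; inj₁; inj₂)
open import Data.List using (List; []; _∷_)
open import Data.List.Relation.Unary.Any using (here; there)
open import Data.List.Membership.Propositional using (_∈_)
open import Relation.Nullary using (¬_)
open import Relation.Binary.PropositionalEquality using (refl; trans; cong₂; subst₂)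

module _ {n : ℕ} (G : Graph n) where

  Used-sym : ∀ {L x y} → Used G L x y → Used G L y x
  Used-sym (inj₁ m) = inj₂ m
  Used-sym (inj₂ m) = inj₁ m

  Used-∷⁺ : ∀ {L p x y} → Used G L x y → Used G (p ∷ L) x y
  Used-∷⁺ (inj₁ m) = inj₁ (there m)
  Used-∷⁺ (inj₂ m) = inj₂ (there m)

  Used-∷⁻ : ∀ {L p x y} → Used G (p ∷ L) x y → Used G (p ∷ []) x y ⊎ Used G L x y
  Used-∷⁻ (inj₁ (here eq)) = inj₁ (inj₁ (here eq))
  Used-∷⁻ (inj₂ (here eq)) = inj₁ (inj₂ (here eq))
  Used-∷⁻ (inj₁ (there m)) = inj₂ (inj₁ m)
  Used-∷⁻ (inj₂ (there m)) = inj₂ (inj₂ m)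

  ClosedUnder : (Fin n → Fin n) → List (Fin n × Fin n) → Set
  ClosedUnder φ L = ∀ {x y} → (x , y) ∈ L → Used G L (φ x) (φ y)

  module _ {φ : Fin n → Fin n} (inv : Involutive G φ) where

    []-closed : ClosedUnder φ []
    []-closed ()

    mirror-∷-closed : ∀ {L} a y → ClosedUnder φ L →
                      ClosedUnder φ ((φ a , φ y) ∷ (a , y) ∷ L)
    mirror-∷-closed a y cl (here refl)         = inj₁ (there (here (cong₂ _,_ (inv a) (inv y))))
    mirror-∷-closed a y cl (there (here refl)) = inj₁ (here refl)
    mirror-∷-closed a y cl (there (there m))   = Used-∷⁺ (Used-∷⁺ (cl m))

    Used-mirror⁻ : ∀ {L x y} → ClosedUnder φ L → Used G L (φ x) (φ y) → Used G L x y
    Used-mirror⁻ {L} {x} {y} cl u = subst₂ (Used G L) (inv x) (inv y) (mirror u)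
      where
      mirror : ∀ {u v} → Used G L u v → Used G L (φ u) (φ v)
      mirror (inj₁ m) = cl m
      mirror (inj₂ m) = Used-sym (cl m)

    mirror-unused : NoFixedEdges G φ → ∀ {L a y} → ClosedUnder φ L →
                    Adj G a y → ¬ Used G L a y → ¬ Used G ((a , y) ∷ L) (φ a) (φ y)
    mirror-unused nfe cl adj unused u with Used-∷⁻ u
    ... | inj₁ (inj₁ (here eq)) = nfe _ _ adj (inj₂ (,-injective eq))
    ... | inj₁ (inj₂ (here eq)) = nfe _ _ adj (inj₁ (swap (,-injective eq)))
    ... | inj₂ old              = unused (Used-mirror⁻ cl old)

  module _ {φ : Fin n → Fin n} (aut : IsAutomorphism G φ) (inv : Involutive G φ)
           (nfe : NoFixedEdges G φ) where

    Adj-mirror : ∀ {a y} → Adj G a y → Adj G (φ a) (φ y)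
    Adj-mirror {a} {y} adj = trans (aut a y) adj

    mirrored-¬Wins : ∀ {a L} → ClosedUnder φ L → ¬ Wins G a (φ a) L
    mirrored-¬Wins cl (win y adj unused (lose replies)) =
      mirrored-¬Wins (mirror-∷-closed inv _ y cl)
        (replies (φ y) (Adj-mirror adj) (mirror-unused inv nfe cl adj unused))

proposition2p3 : ∀ {n : ℕ} (G : Graph n) →
    (∃[ φ ] (IsAutomorphism G φ × Involutive G φ × NoFixedEdges G φ)) →
    P2-win G
proposition2p3 G (φ , aut , inv , nfe) (v , w , adj , strategy) =
  mirrored-¬Wins G aut inv nfe (mirror-∷-closed G inv v w ([]-closed G inv))
    (strategy (φ v) (φ w) (Adj-mirror G aut inv nfe adj)
      (mirror-unused G inv nfe ([]-closed G inv) adj λ { (inj₁ ()) ; (inj₂ ()) }))
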